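{- Let $k>1$ be an integer. The concatenation $r\circ r$ of any $k$-reverse multiple $r$ with itself is again a $k$-reverse multiple.
   Context: For positive integers $a_0,\ldots,a_n$, $[a_0;a_1,\ldots,a_n]$ denotes the finite simple continued fraction $a_0+1/(a_1+1/(\cdots+1/a_n))$; all finite continued fractions are assumed in canonical form (last digit at least $2$ when there are at least two digits). A $k$-reverse multiple is a continued fraction $r=[a_0;a_1,\ldots,a_n]$ with $r=k\,[a_n;a_{n-1},\ldots,a_0]$. For $c_1=[b_0;\ldots,b_n]$, $c_2=[b'_0;\ldots,b'_m]$ the concatenation is $c_1\circ c_2=[b_0;\ldots,b_n,b'_0,\ldots,b'_m]$. -}

module Defs where

open import Data.Nat using (ℕ; zero; suc; _+_; _*_; _≤_)
open import Data.Product using (_×_; _,_; proj₁; proj₂)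
open import Data.List using (List; []; _∷_)
open import Data.List.NonEmpty as List⁺ using (List⁺; _∷_; _⁺++⁺_; last)
open import Data.List.Relation.Unary.All using (All)
open import Data.Unit using (⊤)
open import Relation.Binary.PropositionalEquality using (_≡_)

-- A finite simple continued fraction [a₀; a₁, …, aₙ] is represented by its
-- non-empty list of digits a₀ ∷ a₁ ∷ … ∷ aₙ.
CF : Set
CF = List⁺ ℕ

-- Numerator and denominator (p , q) of the value, by the standard recursion
-- [a] = a/1,  [a; rest] = a + 1/[rest] = (a·p + q)/p  where [rest] = p/q.
fracL : ℕ → List ℕ → ℕ × ℕ
fracL a []       = a , 1
fracL a (b ∷ bs) = let pq = fracL b bs in a * proj₁ pq + proj₂ pq , proj₁ pq

num : CF → ℕ
num (a ∷ as) = proj₁ (fracL a as)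

den : CF → ℕ
den (a ∷ as) = proj₂ (fracL a as)

Positive : CF → Set
Positive c = All (λ a → 1 ≤ a) (List⁺.toList c)

Canonical : CF → Set
Canonical (a ∷ [])     = ⊤
Canonical (a ∷ b ∷ bs) = 2 ≤ last (a ∷ b ∷ bs)

ValidCF : CF → Set
ValidCF c = Positive c × Canonical c

rev : CF → CF
rev = List⁺.reverse

_∘cf_ : CF → CF → CF
c₁ ∘cf c₂ = c₁ ⁺++⁺ c₂

-- r is a k-reverse multiple: value(r) = k · value(rev r), i.e. the rational
-- equality num r / den r = k · num (rev r) / den (rev r), written by
-- cross-multiplication (denominators are positive).
ReverseMultiple : ℕ → CF → Set
ReverseMultiple k r = ValidCF r × (num r * den (rev r) ≡ k * num (rev r) * den r)

module Submission where

-- Write the digits of r = [a₀; a₁, …, aₙ] as the product of matrices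
--   X = (a₀ 1; 1 0) ⋯ (aₙ 1; 1 0) = (p p'; q q').
-- Its first column gives the value, r = p/q, and since every digit matrix is
-- symmetric the matrix of the reversed fraction is the transpose Xᵀ, so
-- rev r = p/p'.  Hence, for positive digits (p ≠ 0), r = k · rev r holds iff
-- p' = k·q, i.e. iff X is "k-balanced".  Concatenation multiplies matrices,
-- so r ∘ r has matrix X², and a one-line computation shows X² is k-balanced
-- whenever X is.  Validity of r ∘ r is bookkeeping: its digits are those of r
-- twice, and its last digit is the last digit of r, which is ≥ 2 because a
-- single-digit fraction [a] = k·[a] forces k = 1.

open import Defs
open import Data.Nat using (ℕ; suc; _<_; _+_; _*_; _≤_; s≤s; z≤n; NonZero; >-nonZero)
open import Data.Nat.Properties using (*-cancelˡ-≡; *-mono-≤; ≤-trans; m≤m+n; <-irrefl; *-identityʳ; *-zeroʳ)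
open import Data.Nat.Tactic.RingSolver using (solve-∀)
open import Data.Product using (_,_; proj₁; proj₂)
open import Data.List as List using (List; []; _∷_; _++_)
open import Data.List.Properties using (unfold-reverse)
open import Data.List.NonEmpty as List⁺ using (List⁺; _∷_; _⁺++⁺_; last)
import Data.Vec as Vec
import Data.Vec.Properties as Vec
open import Data.List.Relation.Unary.All using (All; _∷_)
open import Data.List.Relation.Unary.All.Properties using (++⁺)
open import Data.Empty using (⊥-elim)
open import Relation.Nullary using (¬_)
open import Relation.Binary.PropositionalEquality

record Mat : Set where
  constructor mat
  field
    m00 m01 m10 m11 : ℕ
open Mat

infixl 7 _⊗_
_⊗_ : Mat → Mat → Mat
mat a b c d ⊗ mat e f g h =
  mat (a * e + b * g) (a * f + b * h) (c * e + d * g) (c * f + d * h)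

transpose : Mat → Mat
transpose (mat a b c d) = mat a c b d

I : Mat
I = mat 1 0 0 1

mat≡ : ∀ {a b c d a' b' c' d'} →
       a ≡ a' → b ≡ b' → c ≡ c' → d ≡ d' → mat a b c d ≡ mat a' b' c' d'
mat≡ refl refl refl refl = refl

-- Each entry of (PQ)R and P(QR) is a row of P against a column of R through Q;
-- the four entries are instances of this single identity.
entry-assoc : ∀ a b e f g h i k →
  (a * e + b * g) * i + (a * f + b * h) * k ≡ a * (e * i + f * k) + b * (g * i + h * k)
entry-assoc = solve-∀

⊗-assoc : ∀ P Q R → (P ⊗ Q) ⊗ R ≡ P ⊗ (Q ⊗ R)
⊗-assoc (mat a b c d) (mat e f g h) (mat i j k l) = mat≡
  (entry-assoc a b e f g h i k) (entry-assoc a b e f g h j l)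
  (entry-assoc c d e f g h i k) (entry-assoc c d e f g h j l)

entry-comm : ∀ a b e g → a * e + b * g ≡ e * a + g * b
entry-comm = solve-∀

transpose-⊗ : ∀ P Q → transpose (P ⊗ Q) ≡ transpose Q ⊗ transpose P
transpose-⊗ (mat a b c d) (mat e f g h) = mat≡
  (entry-comm a b e g) (entry-comm c d e g) (entry-comm a b f h) (entry-comm c d f h)

transpose-involutive : ∀ P → transpose (transpose P) ≡ P
transpose-involutive (mat a b c d) = refl

unit-first : ∀ x y → x * 1 + y * 0 ≡ x
unit-first = solve-∀

unit-second : ∀ x y → x * 0 + y * 1 ≡ y
unit-second = solve-∀

⊗-identityʳ : ∀ P → P ⊗ I ≡ P
⊗-identityʳ (mat a b c d) =
  mat≡ (unit-first a b) (unit-second a b) (unit-first c d) (unit-second c d)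

⊗-identityˡ : ∀ P → I ⊗ P ≡ P
⊗-identityˡ P = begin
  I ⊗ P                                   ≡⟨ transpose-involutive (I ⊗ P) ⟨
  transpose (transpose (I ⊗ P))           ≡⟨ cong transpose (transpose-⊗ I P) ⟩
  transpose (transpose P ⊗ I)             ≡⟨ cong transpose (⊗-identityʳ (transpose P)) ⟩
  transpose (transpose P)                 ≡⟨ transpose-involutive P ⟩
  P                                       ∎
  where open ≡-Reasoning

digitMatrix : ℕ → Mat
digitMatrix a = mat a 1 1 0

digitsMatrix : List ℕ → Mat
digitsMatrix []       = I
digitsMatrix (a ∷ as) = digitMatrix a ⊗ digitsMatrix as

digitsMatrix-++ : ∀ xs ys → digitsMatrix (xs ++ ys) ≡ digitsMatrix xs ⊗ digitsMatrix ys
digitsMatrix-++ []       ys = sym (⊗-identityˡ (digitsMatrix ys))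
digitsMatrix-++ (x ∷ xs) ys = begin
  digitMatrix x ⊗ digitsMatrix (xs ++ ys)                 ≡⟨ cong (digitMatrix x ⊗_) (digitsMatrix-++ xs ys) ⟩
  digitMatrix x ⊗ (digitsMatrix xs ⊗ digitsMatrix ys)     ≡⟨ ⊗-assoc (digitMatrix x) (digitsMatrix xs) (digitsMatrix ys) ⟨
  digitMatrix x ⊗ digitsMatrix xs ⊗ digitsMatrix ys       ∎
  where open ≡-Reasoning

-- Digit matrices are symmetric, so reversing the digits transposes the matrix.
digitsMatrix-reverse : ∀ xs → digitsMatrix (List.reverse xs) ≡ transpose (digitsMatrix xs)
digitsMatrix-reverse []       = refl
digitsMatrix-reverse (x ∷ xs) = begin
  digitsMatrix (List.reverse (x ∷ xs))                      ≡⟨ cong digitsMatrix (unfold-reverse x xs) ⟩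
  digitsMatrix (List.reverse xs ++ x ∷ [])                  ≡⟨ digitsMatrix-++ (List.reverse xs) (x ∷ []) ⟩
  digitsMatrix (List.reverse xs) ⊗ (digitMatrix x ⊗ I)      ≡⟨ cong₂ _⊗_ (digitsMatrix-reverse xs) (⊗-identityʳ (digitMatrix x)) ⟩
  transpose (digitsMatrix xs) ⊗ transpose (digitMatrix x)   ≡⟨ transpose-⊗ (digitMatrix x) (digitsMatrix xs) ⟨
  transpose (digitsMatrix (x ∷ xs))                         ∎
  where open ≡-Reasoning

top-left-positive : ∀ xs → All (1 ≤_) xs → 1 ≤ m00 (digitsMatrix xs)
top-left-positive []       _          = s≤s z≤n
top-left-positive (a ∷ as) (1≤a ∷ ps) =
  ≤-trans (*-mono-≤ 1≤a (top-left-positive as ps)) (m≤m+n (a * m00 (digitsMatrix as)) _)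

matrixOf : CF → Mat
matrixOf c = digitsMatrix (List⁺.toList c)

matrixOf-∘ : ∀ c₁ c₂ → matrixOf (c₁ ∘cf c₂) ≡ matrixOf c₁ ⊗ matrixOf c₂
matrixOf-∘ c₁ c₂ = digitsMatrix-++ (List⁺.toList c₁) (List⁺.toList c₂)

-- Reversal of non-empty lists goes through vectors; on the underlying lists
-- it is List.reverse.
toList-fromVec : ∀ {n} (v : Vec.Vec ℕ (suc n)) → List⁺.toList (List⁺.fromVec v) ≡ Vec.toList v
toList-fromVec (x Vec.∷ xs) = refl

toList-rev : ∀ c → List⁺.toList (rev c) ≡ List.reverse (List⁺.toList c)
toList-rev (a ∷ as) = begin
  List⁺.toList (List⁺.fromVec (Vec.reverse v))  ≡⟨ toList-fromVec (Vec.reverse v) ⟩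
  Vec.toList (Vec.reverse v)                    ≡⟨ Vec.toList-reverse v ⟩
  List.reverse (a ∷ Vec.toList (Vec.fromList as)) ≡⟨ cong (λ l → List.reverse (a ∷ l)) (Vec.toList∘fromList as) ⟩
  List.reverse (a ∷ as)                         ∎
  where
  v : Vec.Vec ℕ (suc (List.length as))
  v = a Vec.∷ Vec.fromList as
  open ≡-Reasoning

matrixOf-rev : ∀ c → matrixOf (rev c) ≡ transpose (matrixOf c)
matrixOf-rev c = trans (cong digitsMatrix (toList-rev c)) (digitsMatrix-reverse (List⁺.toList c))

digit-step : ∀ a X → digitMatrix a ⊗ X ≡ mat (a * m00 X + m10 X) (a * m01 X + m11 X) (m00 X) (m01 X)
digit-step a (mat p p' q q') = mat≡ (row a p q) (row a p' q') (column p q) (column p' q')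
  where
  row : ∀ a x y → a * x + 1 * y ≡ a * x + y
  row = solve-∀
  column : ∀ x y → 1 * x + 0 * y ≡ x
  column = solve-∀

fracL-column : ∀ a as → fracL a as ≡ (m00 (matrixOf (a ∷ as)) , m10 (matrixOf (a ∷ as)))
fracL-column a []       = cong (λ X → m00 X , m10 X) (sym (⊗-identityʳ (digitMatrix a)))
fracL-column a (b ∷ bs) = begin
  (a * proj₁ (fracL b bs) + proj₂ (fracL b bs) , proj₁ (fracL b bs))
      ≡⟨ cong (λ pq → a * proj₁ pq + proj₂ pq , proj₁ pq) (fracL-column b bs) ⟩
  (a * m00 Y + m10 Y , m00 Y)
      ≡⟨ cong (λ X → m00 X , m10 X) (digit-step a Y) ⟨
  (m00 (digitMatrix a ⊗ Y) , m10 (digitMatrix a ⊗ Y))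
      ∎
  where
  Y : Mat
  Y = matrixOf (b ∷ bs)
  open ≡-Reasoning

num-matrix : ∀ c → num c ≡ m00 (matrixOf c)
num-matrix (a ∷ as) = cong proj₁ (fracL-column a as)

den-matrix : ∀ c → den c ≡ m10 (matrixOf c)
den-matrix (a ∷ as) = cong proj₂ (fracL-column a as)

ReverseEquation : ℕ → CF → Set
ReverseEquation k c = num c * den (rev c) ≡ k * num (rev c) * den c

reverseEquation-lhs : ∀ c → num c * den (rev c) ≡ m00 (matrixOf c) * m01 (matrixOf c)
reverseEquation-lhs c =
  cong₂ _*_ (num-matrix c) (trans (den-matrix (rev c)) (cong m10 (matrixOf-rev c)))

reverseEquation-rhs : ∀ k c → k * num (rev c) * den c ≡ k * m00 (matrixOf c) * m10 (matrixOf c)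
reverseEquation-rhs k c =
  cong₂ (λ x y → k * x * y) (trans (num-matrix (rev c)) (cong m00 (matrixOf-rev c))) (den-matrix c)

Balanced : ℕ → Mat → Set
Balanced k X = m01 X ≡ k * m10 X

-- Rearranging k·p·q so that p can be cancelled from p·p' = k·p·q.
scale-middle : ∀ k p q → k * p * q ≡ p * (k * q)
scale-middle = solve-∀

-- For positive digits p ≠ 0 may be cancelled: the equation forces balance ...
equation⇒balanced : ∀ k c → Positive c → ReverseEquation k c → Balanced k (matrixOf c)
equation⇒balanced k c pos eq = *-cancelˡ-≡ p' (k * q) p {{p-nonZero}} (begin
  p * p'                    ≡⟨ reverseEquation-lhs c ⟨
  num c * den (rev c)       ≡⟨ eq ⟩
  k * num (rev c) * den c   ≡⟨ reverseEquation-rhs k c ⟩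
  k * p * q                 ≡⟨ scale-middle k p q ⟩
  p * (k * q)               ∎)
  where
  open Mat (matrixOf c) renaming (m00 to p; m01 to p'; m10 to q)
  p-nonZero : NonZero p
  p-nonZero = >-nonZero (top-left-positive (List⁺.toList c) pos)
  open ≡-Reasoning

balanced⇒equation : ∀ k c → Balanced k (matrixOf c) → ReverseEquation k c
balanced⇒equation k c bal = begin
  num c * den (rev c)       ≡⟨ reverseEquation-lhs c ⟩
  p * p'                    ≡⟨ cong (p *_) bal ⟩
  p * (k * q)               ≡⟨ scale-middle k p q ⟨
  k * p * q                 ≡⟨ reverseEquation-rhs k c ⟨
  k * num (rev c) * den c   ∎
  where
  open Mat (matrixOf c) renaming (m00 to p; m01 to p'; m10 to q)
  open ≡-Reasoning

balanced-square : ∀ k X → Balanced k X → Balanced k (X ⊗ X)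
balanced-square k (mat p .(k * q) q q') refl = square k p q q'
  where
  square : ∀ k p q q' → p * (k * q) + k * q * q' ≡ k * (q * p + q' * q)
  square = solve-∀

-- A single digit [a] is never a k-reverse multiple for k > 1: its matrix
-- (a 1; 1 0) would need 1 = k·1.
single-digit-unbalanced : ∀ {k} a → 1 < k → ¬ Balanced k (matrixOf (a ∷ []))
single-digit-unbalanced {k} a k>1 bal = <-irrefl 1≡k k>1
  where
  1≡k : 1 ≡ k
  1≡k = begin
    1          ≡⟨ cong (_+ 1) (*-zeroʳ a) ⟨
    a * 0 + 1  ≡⟨ bal ⟩
    k * 1      ≡⟨ *-identityʳ k ⟩
    k          ∎
    where open ≡-Reasoning

last-∷ : ∀ {A : Set} (x y : A) ys → last (x ∷ y ∷ ys) ≡ last (y ∷ ys)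
last-∷ x y ys with List.initLast ys
... | []             = refl
... | zs List.∷ʳ′ z  = refl

last-⁺++⁺ : ∀ {A : Set} (xs ys : List⁺ A) → last (xs ⁺++⁺ ys) ≡ last ys
last-⁺++⁺ (x ∷ xs) (y ∷ ys) = last-++ x xs
  where
  last-++ : ∀ x xs → last (x ∷ (xs ++ y ∷ ys)) ≡ last (y ∷ ys)
  last-++ x []        = last-∷ x y ys
  last-++ x (x' ∷ xs) = trans (last-∷ x x' (xs ++ y ∷ ys)) (last-++ x' xs)

-- A concatenation has at least two digits, so it is canonical as soon as the
-- last digit of its second part is at least 2.
canonical-∘ : ∀ c₁ c₂ → 2 ≤ last c₂ → Canonical (c₁ ∘cf c₂)
canonical-∘ c₁@(_ ∷ [])    c₂@(_ ∷ _) 2≤last = subst (2 ≤_) (sym (last-⁺++⁺ c₁ c₂)) 2≤last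
canonical-∘ c₁@(_ ∷ _ ∷ _) c₂@(_ ∷ _) 2≤last = subst (2 ≤_) (sym (last-⁺++⁺ c₁ c₂)) 2≤last

canonical-square : ∀ {k} → 1 < k → ∀ r → Canonical r → Balanced k (matrixOf r) → Canonical (r ∘cf r)
canonical-square k>1 (a ∷ [])    _   bal = ⊥-elim (single-digit-unbalanced a k>1 bal)
canonical-square k>1 r@(_ ∷ _ ∷ _) can _ = canonical-∘ r r can

corollary24 : (k : ℕ) → 1 < k → (r : CF) →
    ReverseMultiple k r → ReverseMultiple k (r ∘cf r)
corollary24 k k>1 r ((pos , can) , eq) =
  (++⁺ pos pos , canonical-square k>1 r can balanced) , balanced⇒equation k (r ∘cf r) balanced²
  where
  balanced : Balanced k (matrixOf r)
  balanced = equation⇒balanced k r pos eq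
  balanced² : Balanced k (matrixOf (r ∘cf r))
  balanced² = subst (Balanced k) (sym (matrixOf-∘ r r)) (balanced-square k (matrixOf r) balanced)
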